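{- Let $G$ be a graph of order $n\geq 2$ with no isolated vertices. Then $n-\gamma_2(G)\leq \operatorname{ZIR}(G)\leq n-\gamma(G)$. Both bounds are sharp, i.e., each of the two inequalities holds with equality for some such graph $G$.
   Context: $\gamma(G)$ is the domination number (minimum size of a set $D$ such that every vertex is in $D$ or adjacent to a vertex of $D$). A 2-dominating set is $D\subseteq V(G)$ such that every vertex not in $D$ is adjacent to at least two vertices of $D$; $\gamma_2(G)$ is the minimum size of a 2-dominating set. A fort is a nonempty $F\subseteq V(G)$ such that every $v\notin F$ has $|F\cap N(v)|\neq 1$. For $S\subseteq V(G)$, $x\in S$, a private fort of $x$ relative to $S$ is a fort $F$ with $S\cap F=\{x\}$; $S$ is a ZIr-set if every element has a private fort. $\operatorname{ZIR}(G)$ is the maximum cardinality of an inclusion-maximal ZIr-set of $G$. -}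

module Defs where

open import Data.Nat using (ℕ; _≤_)
open import Data.Bool using (Bool; true; false)
open import Data.Fin using (Fin)
open import Data.Fin.Subset using (Subset; _∈_; _∉_; _⊆_; _∩_; ∣_∣; ⁅_⁆; Nonempty)
open import Data.Vec using (tabulate)
open import Data.Product using (Σ; ∃; _×_)
open import Data.Sum using (_⊎_)
open import Relation.Binary.PropositionalEquality using (_≡_; _≢_)

record Graph (n : ℕ) : Set where
  field
    adj     : Fin n → Fin n → Bool
    adj-sym : ∀ u v → adj u v ≡ adj v u
    loopless : ∀ v → adj v v ≡ false

open Graph public

Adj : ∀ {n} → Graph n → Fin n → Fin n → Set
Adj G u v = adj G u v ≡ true

N : ∀ {n} → Graph n → Fin n → Subset n
N G v = tabulate (adj G v)

NoIsolatedVertices : ∀ {n} → Graph n → Set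
NoIsolatedVertices {n} G = ∀ (v : Fin n) → ∃ λ u → Adj G v u

IsDominating : ∀ {n} → Graph n → Subset n → Set
IsDominating {n} G D = ∀ (v : Fin n) → v ∈ D ⊎ (∃ λ u → u ∈ D × Adj G u v)

Is2Dominating : ∀ {n} → Graph n → Subset n → Set
Is2Dominating {n} G D = ∀ (v : Fin n) → v ∉ D →
  ∃ λ u → ∃ λ w → u ≢ w × u ∈ D × w ∈ D × Adj G u v × Adj G w v

IsMinSize : ∀ {n} → (Subset n → Set) → ℕ → Set
IsMinSize {n} P k = (∃ λ D → P D × ∣ D ∣ ≡ k) × (∀ D → P D → k ≤ ∣ D ∣)

IsMaxSize : ∀ {n} → (Subset n → Set) → ℕ → Set
IsMaxSize {n} P k = (∃ λ D → P D × ∣ D ∣ ≡ k) × (∀ D → P D → ∣ D ∣ ≤ k)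

IsDominationNumber : ∀ {n} → Graph n → ℕ → Set
IsDominationNumber G = IsMinSize (IsDominating G)

Is2DominationNumber : ∀ {n} → Graph n → ℕ → Set
Is2DominationNumber G = IsMinSize (Is2Dominating G)

IsFort : ∀ {n} → Graph n → Subset n → Set
IsFort {n} G F = Nonempty F × (∀ (v : Fin n) → v ∉ F → ∣ F ∩ N G v ∣ ≢ 1)

IsPrivateFort : ∀ {n} → Graph n → Subset n → Fin n → Subset n → Set
IsPrivateFort G S x F = IsFort G F × S ∩ F ≡ ⁅ x ⁆

IsZIrSet : ∀ {n} → Graph n → Subset n → Set
IsZIrSet {n} G S = ∀ (x : Fin n) → x ∈ S → ∃ λ F → IsPrivateFort G S x F

IsMaximalZIrSet : ∀ {n} → Graph n → Subset n → Set
IsMaximalZIrSet G S = IsZIrSet G S × (∀ T → S ⊆ T → IsZIrSet G T → T ⊆ S)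

IsZIR : ∀ {n} → Graph n → ℕ → Set
IsZIR G = IsMaxSize (IsMaximalZIrSet G)

-- If D is a 2-dominating set, every vertex x outside D has the private fort D ∪ {x}
-- relative to the complement of D, since each vertex outside a superset of D sees at
-- least two of its vertices; so the complement of a minimum 2-dominating set extends to
-- a maximal ZIr-set, giving n − γ₂ ≤ ZIR. Conversely, the complement of a ZIr-set S
-- dominates: a vertex v ∈ S all of whose neighbours lie in S has some neighbour u ∈ S,
-- and a private fort F of u meets N(v) exactly in u although v ∉ F. Both bounds are
-- attained by the 4-cycle, where γ = γ₂ = 2 forces ZIR = 2.
module Submission where

open import Defs
open import Data.Nat using (ℕ; _≤_; _∸_; zero; suc; _<_; s≤s; z≤n)
open import Data.Nat.Properties
  using (_≟_; _<?_; <-irrefl; ≤-trans; ≤-antisym; ≤-pred; ≤∧≢⇒<; <⇒≱; ≮⇒≥; n≤0⇒n≡0; ∸-monoʳ-≤; m∸[m∸n]≡n; module ≤-Reasoning)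
open import Data.Product using (Σ; ∃; _×_; _,_; proj₁; proj₂)
open import Data.Sum using (inj₁; inj₂)
open import Data.Bool using (Bool; true; false; _xor_)
open import Data.Bool.Properties using (xor-comm; xor-same)
import Data.Bool.Properties as Bool
open import Data.Empty using (⊥-elim)
open import Data.Fin using (Fin; zero; suc)
open import Data.Fin.Subset
  using (Subset; _∈_; _∉_; _⊆_; _∩_; _∪_; ∁; ∣_∣; ⁅_⁆; Nonempty; inside; outside) renaming (⊥ to ∅)
open import Data.Fin.Subset.Properties
open import Data.Fin.Properties using (all?; any?)
open import Data.Vec using (_∷_; []; here; there)
open import Data.Vec.Properties using (≡-dec; []=⇒lookup; lookup⇒[]=; lookup∘tabulate)
open import Relation.Nullary using (Dec; yes; no; ¬_)
open import Relation.Nullary.Decidable using (_×-dec_; _⊎-dec_; _→-dec_; ¬?; decidable-stable; toWitnessFalse)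
open import Relation.Unary using (Pred; Decidable)
open import Relation.Binary.PropositionalEquality using (_≡_; refl; sym; trans; cong; subst; _≢_)

p⊆q∧∣q∣≤∣p∣⇒q⊆p : ∀ {n} {p q : Subset n} → p ⊆ q → ∣ q ∣ ≤ ∣ p ∣ → q ⊆ p
p⊆q∧∣q∣≤∣p∣⇒q⊆p {p = p} p⊆q ∣q∣≤∣p∣ {x} x∈q with x ∈? p
... | yes x∈p = x∈p
... | no x∉p = ⊥-elim (<⇒≱ (p⊂q⇒∣p∣<∣q∣ (p⊆q , x , x∈q , x∉p)) ∣q∣≤∣p∣)

x∈p⇒1≤∣p∣ : ∀ {n} {p : Subset n} {x} → x ∈ p → 1 ≤ ∣ p ∣
x∈p⇒1≤∣p∣ {p = p} {x} x∈p = subst (_≤ ∣ p ∣) (∣⁅x⁆∣≡1 x) (p⊆q⇒∣p∣≤∣q∣ ⁅x⁆⊆p)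
  where
  ⁅x⁆⊆p : ⁅ x ⁆ ⊆ p
  ⁅x⁆⊆p y∈⁅x⁆ = subst (_∈ p) (sym (x∈⁅y⁆⇒x≡y x y∈⁅x⁆)) x∈p

x∈p∧y∈p∧x≢y⇒2≤∣p∣ : ∀ {n} {p : Subset n} {x y} → x ∈ p → y ∈ p → x ≢ y → 2 ≤ ∣ p ∣
x∈p∧y∈p∧x≢y⇒2≤∣p∣ x∈p y∈p x≢y =
  ≤-trans (s≤s (x∈p⇒1≤∣p∣ (x∈p∧x≢y⇒x∈p-y y∈p (λ y≡x → x≢y (sym y≡x))))) (x∈p⇒∣p-x∣<∣p∣ x∈p)

x∈∁p⇒∁p∩[p∪⁅x⁆]≡⁅x⁆ : ∀ {n} {p : Subset n} {x} → x ∈ ∁ p → ∁ p ∩ (p ∪ ⁅ x ⁆) ≡ ⁅ x ⁆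
x∈∁p⇒∁p∩[p∪⁅x⁆]≡⁅x⁆ {p = p} {x} x∈∁p = ⊆-antisym ⊆⁅x⁆ ⁅x⁆⊆
  where
  ⊆⁅x⁆ : ∁ p ∩ (p ∪ ⁅ x ⁆) ⊆ ⁅ x ⁆
  ⊆⁅x⁆ y∈ with x∈p∩q⁻ (∁ p) _ y∈
  ... | y∈∁p , y∈p∪⁅x⁆ with x∈p∪q⁻ p _ y∈p∪⁅x⁆
  ... | inj₁ y∈p    = ⊥-elim (x∈∁p⇒x∉p y∈∁p y∈p)
  ... | inj₂ y∈⁅x⁆ = y∈⁅x⁆
  ⁅x⁆⊆ : ⁅ x ⁆ ⊆ ∁ p ∩ (p ∪ ⁅ x ⁆)
  ⁅x⁆⊆ y∈⁅x⁆ with refl ← x∈⁅y⁆⇒x≡y x y∈⁅x⁆ = x∈p∩q⁺ (x∈∁p , x∈p∪q⁺ (inj₂ (x∈⁅x⁆ x)))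

∃-IsMaxSize : ∀ {n} {P : Pred (Subset n) _} → Decidable P → ∃ P → ∃ (IsMaxSize P)
∃-IsMaxSize {n} {P} P? (D₀ , PD₀) = search n (λ D _ → ∣p∣≤n D)
  where
  search : ∀ k → (∀ D → P D → ∣ D ∣ ≤ k) → ∃ (IsMaxSize P)
  search k bound with anySubset? (λ D → P? D ×-dec (∣ D ∣ ≟ k))
  ... | yes attained = k , attained , bound
  search zero    bound | no notAttained = ⊥-elim (notAttained (D₀ , PD₀ , n≤0⇒n≡0 (bound D₀ PD₀)))
  search (suc k) bound | no notAttained =
    search k (λ D PD → ≤-pred (≤∧≢⇒< (bound D PD) (λ ∣D∣≡k → notAttained (D , PD , ∣D∣≡k))))

module _ {n : ℕ} (G : Graph n) where

  adj? : ∀ u v → Dec (Adj G u v)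
  adj? u v = adj G u v Bool.≟ true

  Adj-sym : ∀ {u v} → Adj G u v → Adj G v u
  Adj-sym {u} {v} = trans (adj-sym G v u)

  Adj⇒≢ : ∀ {u v} → Adj G u v → u ≢ v
  Adj⇒≢ {u} Adj-uu refl with trans (sym Adj-uu) (loopless G u)
  ... | ()

  ∈N⇒Adj : ∀ {v u} → u ∈ N G v → Adj G v u
  ∈N⇒Adj {v} {u} u∈N = trans (sym (lookup∘tabulate (adj G v) u)) ([]=⇒lookup u∈N)

  Adj⇒∈N : ∀ {v u} → Adj G v u → u ∈ N G v
  Adj⇒∈N {v} {u} Adj-vu = lookup⇒[]= u _ (trans (lookup∘tabulate (adj G v) u) Adj-vu)

  isFort? : Decidable (IsFort G)
  isFort? F = nonempty? F ×-dec all? (λ v → ¬? (v ∈? F) →-dec ¬? (∣ F ∩ N G v ∣ ≟ 1))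

  isDominating? : Decidable (IsDominating G)
  isDominating? D = all? (λ v → v ∈? D ⊎-dec any? (λ u → u ∈? D ×-dec adj? u v))

  isPrivateFort? : ∀ S x → Decidable (IsPrivateFort G S x)
  isPrivateFort? S x F = isFort? F ×-dec ≡-dec Bool._≟_ (S ∩ F) ⁅ x ⁆

  isZIrSet? : Decidable (IsZIrSet G)
  isZIrSet? S = all? (λ x → x ∈? S →-dec anySubset? (isPrivateFort? S x))

  largestZIrSet⊇ : ∀ {S} → IsZIrSet G S → ∃ λ T →
    S ⊆ T × IsMaximalZIrSet G T × (∀ T′ → S ⊆ T′ → IsZIrSet G T′ → ∣ T′ ∣ ≤ ∣ T ∣)
  largestZIrSet⊇ {S} S-ZIr
    with ∃-IsMaxSize (λ T → isZIrSet? T ×-dec S ⊆? T) (S , S-ZIr , ⊆-refl)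
  ... | _ , (T , (T-ZIr , S⊆T) , refl) , largest =
    T , S⊆T , (T-ZIr , isMaximal) , λ T′ S⊆T′ T′-ZIr → largest T′ (T′-ZIr , S⊆T′)
    where
    isMaximal : ∀ T′ → T ⊆ T′ → IsZIrSet G T′ → T′ ⊆ T
    isMaximal T′ T⊆T′ T′-ZIr = p⊆q∧∣q∣≤∣p∣⇒q⊆p T⊆T′ (largest T′ (T′-ZIr , ⊆-trans S⊆T T⊆T′))

  ∃-IsZIR : ∃ (IsZIR G)
  ∃-IsZIR with largestZIrSet⊇ {∅} (λ _ x∈∅ → ⊥-elim (∉⊥ x∈∅))
  ... | T , _ , T-max , largest =
    ∣ T ∣ , (T , T-max , refl) , λ T′ T′-max → largest T′ (⊆-min T′) (proj₁ T′-max)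

  ⊇2Dominating⇒IsFort : ∀ {D F} → Is2Dominating G D → D ⊆ F → Nonempty F → IsFort G F
  ⊇2Dominating⇒IsFort {D} {F} D-2dom D⊆F F≢∅ = F≢∅ , noSingleNeighbour
    where
    noSingleNeighbour : ∀ v → v ∉ F → ∣ F ∩ N G v ∣ ≢ 1
    noSingleNeighbour v v∉F ∣F∩Nv∣≡1 with D-2dom v (λ v∈D → v∉F (D⊆F v∈D))
    ... | u , w , u≢w , u∈D , w∈D , Adj-uv , Adj-wv = <-irrefl refl (subst (2 ≤_) ∣F∩Nv∣≡1
      (x∈p∧y∈p∧x≢y⇒2≤∣p∣ (x∈p∩q⁺ (D⊆F u∈D , Adj⇒∈N (Adj-sym Adj-uv)))
                          (x∈p∩q⁺ (D⊆F w∈D , Adj⇒∈N (Adj-sym Adj-wv))) u≢w))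

  ∁2Dominating-isZIrSet : ∀ {D} → Is2Dominating G D → IsZIrSet G (∁ D)
  ∁2Dominating-isZIrSet {D} D-2dom x x∈∁D =
    D ∪ ⁅ x ⁆ , ⊇2Dominating⇒IsFort D-2dom (p⊆p∪q _) (x , x∈p∪q⁺ (inj₂ (x∈⁅x⁆ x))) , x∈∁p⇒∁p∩[p∪⁅x⁆]≡⁅x⁆ x∈∁D

  N⊆S⇒F∩N≡⁅u⁆ : ∀ {S F u v} → N G v ⊆ S → S ∩ F ≡ ⁅ u ⁆ → Adj G v u → F ∩ N G v ≡ ⁅ u ⁆
  N⊆S⇒F∩N≡⁅u⁆ {S} {F} {u} {v} N⊆S S∩F≡⁅u⁆ Adj-vu = ⊆-antisym ⊆⁅u⁆ ⁅u⁆⊆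
    where
    ⊆⁅u⁆ : F ∩ N G v ⊆ ⁅ u ⁆
    ⊆⁅u⁆ {w} w∈ with x∈p∩q⁻ F _ w∈
    ... | w∈F , w∈N = subst (w ∈_) S∩F≡⁅u⁆ (x∈p∩q⁺ (N⊆S w∈N , w∈F))
    ⁅u⁆⊆ : ⁅ u ⁆ ⊆ F ∩ N G v
    ⁅u⁆⊆ w∈⁅u⁆ with refl ← x∈⁅y⁆⇒x≡y u w∈⁅u⁆ =
      x∈p∩q⁺ (proj₂ (x∈p∩q⁻ S F (subst (u ∈_) (sym S∩F≡⁅u⁆) (x∈⁅x⁆ u))) , Adj⇒∈N Adj-vu)

  ZIrSet⇒N⊈S : ∀ {S u v} → IsZIrSet G S → v ∈ S → Adj G v u → ¬ N G v ⊆ S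
  ZIrSet⇒N⊈S {S} {u} {v} S-ZIr v∈S Adj-vu N⊆S with S-ZIr u (N⊆S (Adj⇒∈N Adj-vu))
  ... | F , (_ , F-fort) , S∩F≡⁅u⁆ =
    F-fort v v∉F (trans (cong ∣_∣ (N⊆S⇒F∩N≡⁅u⁆ N⊆S S∩F≡⁅u⁆ Adj-vu)) (∣⁅x⁆∣≡1 u))
    where
    v∉F : v ∉ F
    v∉F v∈F = Adj⇒≢ Adj-vu (x∈⁅y⁆⇒x≡y u (subst (v ∈_) S∩F≡⁅u⁆ (x∈p∩q⁺ (v∈S , v∈F))))

  ∁ZIrSet-isDominating : NoIsolatedVertices G → ∀ {S} → IsZIrSet G S → IsDominating G (∁ S)
  ∁ZIrSet-isDominating noIsolated {S} S-ZIr v with v ∈? S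
  ... | no v∉S = inj₁ (x∉p⇒x∈∁p v∉S)
  ... | yes v∈S with any? (λ w → w ∈? ∁ S ×-dec adj? w v)
  ...   | yes outsideNeighbour = inj₂ outsideNeighbour
  ...   | no noOutsideNeighbour = ⊥-elim (ZIrSet⇒N⊈S S-ZIr v∈S (proj₂ (noIsolated v)) N⊆S)
    where
    N⊆S : N G v ⊆ S
    N⊆S {w} w∈N = decidable-stable (w ∈? S)
      (λ w∉S → noOutsideNeighbour (w , x∉p⇒x∈∁p w∉S , Adj-sym (∈N⇒Adj w∈N)))

  ZIR≥n∸γ₂ : ∀ {g₂ z} → Is2DominationNumber G g₂ → IsZIR G z → n ∸ g₂ ≤ z
  ZIR≥n∸γ₂ {z = z} ((D , D-2dom , refl) , _) (_ , ZIR-largest)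
    with largestZIrSet⊇ (∁2Dominating-isZIrSet D-2dom)
  ... | T , ∁D⊆T , T-max , _ = begin
    n ∸ ∣ D ∣ ≡⟨ ∣∁p∣≡n∸∣p∣ D ⟨
    ∣ ∁ D ∣   ≤⟨ p⊆q⇒∣p∣≤∣q∣ ∁D⊆T ⟩
    ∣ T ∣     ≤⟨ ZIR-largest T T-max ⟩
    z         ∎
    where open ≤-Reasoning

  ZIR≤n∸γ : NoIsolatedVertices G → ∀ {g z} → IsDominationNumber G g → IsZIR G z → z ≤ n ∸ g
  ZIR≤n∸γ noIsolated {g} (_ , γ-least) ((T , T-max , refl) , _) = begin
    ∣ T ∣           ≡⟨ m∸[m∸n]≡n (∣p∣≤n T) ⟨
    n ∸ (n ∸ ∣ T ∣) ≡⟨ cong (n ∸_) (∣∁p∣≡n∸∣p∣ T) ⟨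
    n ∸ ∣ ∁ T ∣     ≤⟨ ∸-monoʳ-≤ n (γ-least (∁ T) (∁ZIrSet-isDominating noIsolated (proj₁ T-max))) ⟩
    n ∸ g           ∎
    where open ≤-Reasoning

  γ≡γ₂⇒ZIR≡n∸γ : NoIsolatedVertices G → ∀ {g z} →
    IsDominationNumber G g → Is2DominationNumber G g → IsZIR G z → z ≡ n ∸ g
  γ≡γ₂⇒ZIR≡n∸γ noIsolated γ γ₂ ZIR = ≤-antisym (ZIR≤n∸γ noIsolated γ ZIR) (ZIR≥n∸γ₂ γ₂ ZIR)

  2Dominating⇒Dominating : ∀ {D} → Is2Dominating G D → IsDominating G D
  2Dominating⇒Dominating {D} D-2dom v with v ∈? D
  ... | yes v∈D = inj₁ v∈D
  ... | no v∉D with D-2dom v v∉D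
  ...   | u , _ , _ , u∈D , _ , Adj-uv , _ = inj₂ (u , u∈D , Adj-uv)

completeBipartite : ∀ {n} → (Fin n → Bool) → Graph n
completeBipartite colour = record
  { adj      = λ u v → colour u xor colour v
  ; adj-sym  = λ u v → xor-comm (colour u) (colour v)
  ; loopless = λ v → xor-same (colour v)
  }

-- The 4-cycle 0–1–2–3–0 is K₂,₂ with colour classes {0, 2} and {1, 3}.
cycle₄ : Graph 4
cycle₄ = completeBipartite odd
  where
  odd : Fin 4 → Bool
  odd zero                   = false
  odd (suc zero)             = true
  odd (suc (suc zero))       = false
  odd (suc (suc (suc zero))) = true

cycle₄-noIsolatedVertices : NoIsolatedVertices cycle₄
cycle₄-noIsolatedVertices zero                   = suc zero , refl
cycle₄-noIsolatedVertices (suc zero)             = zero , refl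
cycle₄-noIsolatedVertices (suc (suc zero))       = suc zero , refl
cycle₄-noIsolatedVertices (suc (suc (suc zero))) = zero , refl

cycle₄-evens-2Dominating : Is2Dominating cycle₄ (inside ∷ outside ∷ inside ∷ outside ∷ [])
cycle₄-evens-2Dominating zero                   0∉D = ⊥-elim (0∉D here)
cycle₄-evens-2Dominating (suc (suc zero))       2∉D = ⊥-elim (2∉D (there (there here)))
cycle₄-evens-2Dominating (suc zero)             _   =
  zero , suc (suc zero) , (λ ()) , here , there (there here) , refl , refl
cycle₄-evens-2Dominating (suc (suc (suc zero))) _   =
  zero , suc (suc zero) , (λ ()) , here , there (there here) , refl , refl

cycle₄-Dominating⇒2≤∣D∣ : ∀ D → IsDominating cycle₄ D → 2 ≤ ∣ D ∣
cycle₄-Dominating⇒2≤∣D∣ D D-dom = ≮⇒≥ (λ ∣D∣<2 → noSmallDominatingSet (D , D-dom , ∣D∣<2))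
  where
  noSmallDominatingSet : ¬ ∃ λ D → IsDominating cycle₄ D × ∣ D ∣ < 2
  noSmallDominatingSet = toWitnessFalse {a? = anySubset? (λ D → isDominating? cycle₄ D ×-dec ∣ D ∣ <? 2)} _

cycle₄-γ≡2 : IsDominationNumber cycle₄ 2
cycle₄-γ≡2 = (_ , 2Dominating⇒Dominating cycle₄ cycle₄-evens-2Dominating , refl) , cycle₄-Dominating⇒2≤∣D∣

cycle₄-γ₂≡2 : Is2DominationNumber cycle₄ 2
cycle₄-γ₂≡2 = (_ , cycle₄-evens-2Dominating , refl) ,
  λ D D-2dom → cycle₄-Dominating⇒2≤∣D∣ D (2Dominating⇒Dominating cycle₄ D-2dom)

cycle₄-ZIR≡2 : ∃ λ z → IsZIR cycle₄ z × z ≡ 2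
cycle₄-ZIR≡2 with z , ZIR ← ∃-IsZIR cycle₄ =
  z , ZIR , γ≡γ₂⇒ZIR≡n∸γ cycle₄ cycle₄-noIsolatedVertices cycle₄-γ≡2 cycle₄-γ₂≡2 ZIR

proposition4p1 :
    ((n : ℕ) (G : Graph n) → 2 ≤ n → NoIsolatedVertices G →
      ∀ (g g₂ z : ℕ) → IsDominationNumber G g → Is2DominationNumber G g₂ → IsZIR G z →
      (n ∸ g₂ ≤ z) × (z ≤ n ∸ g))
    × (∃ λ n → Σ (Graph n) λ G → 2 ≤ n × NoIsolatedVertices G ×
        (∃ λ g₂ → ∃ λ z → Is2DominationNumber G g₂ × IsZIR G z × z ≡ n ∸ g₂))
    × (∃ λ n → Σ (Graph n) λ G → 2 ≤ n × NoIsolatedVertices G ×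
        (∃ λ g → ∃ λ z → IsDominationNumber G g × IsZIR G z × z ≡ n ∸ g))
proposition4p1 =
  (λ n G _ noIsolated g g₂ z γ γ₂ ZIR → ZIR≥n∸γ₂ G γ₂ ZIR , ZIR≤n∸γ G noIsolated γ ZIR) ,
  (4 , cycle₄ , s≤s (s≤s z≤n) , cycle₄-noIsolatedVertices , 2 , _ , cycle₄-γ₂≡2 , proj₂ cycle₄-ZIR≡2) ,
  (4 , cycle₄ , s≤s (s≤s z≤n) , cycle₄-noIsolatedVertices , 2 , _ , cycle₄-γ≡2 , proj₂ cycle₄-ZIR≡2)
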